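{- Let $R$ be a path. Then: (a) $R$ is backward terminating iff (1) $\mathsf{L}=\overline{\mathsf{L}\mathbin{;}R}\mathbin{;}R\mathbin{;}\mathsf{L}$ or $R=\mathsf{O}$, iff (2) $R\subseteq\overline{\mathsf{L}\mathbin{;}R}\mathbin{;}R\mathbin{;}\mathsf{L}$, iff (3) $R\subseteq\overline{\mathsf{L}\mathbin{;}R}\mathbin{;}R^*$, iff (4) $R\subseteq R^{\top*}\mathbin{;}\overline{R^{\top}\mathbin{;}\mathsf{L}}$. (b) $R$ is forward terminating iff (5) $\mathsf{L}=\mathsf{L}\mathbin{;}R\mathbin{;}\overline{R\mathbin{;}\mathsf{L}}$ or $R=\mathsf{O}$, iff (6) $R\subseteq\mathsf{L}\mathbin{;}R\mathbin{;}\overline{R\mathbin{;}\mathsf{L}}$, iff (7) $R\subseteq R^*\mathbin{;}\overline{R\mathbin{;}\mathsf{L}}$, iff (8) $R\subseteq\overline{\mathsf{L}\mathbin{;}R^{\top}}\mathbin{;}R^{\top*}$. (c) $R$ is terminating iff (9) $\mathsf{L}=\overline{\mathsf{L}\mathbin{;}R}\mathbin{;}R\mathbin{;}\mathsf{L}\cap\mathsf{L}\mathbin{;}R\mathbin{;}\overline{R\mathbin{;}\mathsf{L}}$ or $R=\mathsf{O}$, iff (10) $R\subseteq\overline{\mathsf{L}\mathbin{;}R}\mathbin{;}R\mathbin{;}\mathsf{L}\cap\mathsf{L}\mathbin{;}R\mathbin{;}\overline{R\mathbin{;}\mathsf{L}}$, iff (11) $R\subseteq\overline{\mathsf{L}\mathbin{;}R}\mathbin{;}R^*\cap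 R^*\mathbin{;}\overline{R\mathbin{;}\mathsf{L}}$, iff (12) $R\subseteq R^{\top*}\mathbin{;}\overline{R^{\top}\mathbin{;}\mathsf{L}}\cap\overline{\mathsf{L}\mathbin{;}R^{\top}}\mathbin{;}R^{\top*}$.
   Context: $(B,\cup,\mathbin{;},\overline{\,\cdot\,},{}^{\top},{}^{*},\mathsf{I})$ is a Kleene relation algebra; all variables range over $B$. That is, $(B,\cup,\mathbin{;},\overline{\,\cdot\,},{}^{\top},\mathsf{I})$ is a relation algebra: $\cup$ is associative and commutative and $R=\overline{\overline{R}\cup\overline{S}}\cup\overline{\overline{R}\cup S}$; $\mathbin{;}$ is associative, $(R\cup S)\mathbin{;}T=R\mathbin{;}T\cup S\mathbin{;}T$, $R\mathbin{;}\mathsf{I}=R$; $(R^{\top})^{\top}=R$, $(R\cup S)^{\top}=R^{\top}\cup S^{\top}$, $(R\mathbin{;}S)^{\top}=S^{\top}\mathbin{;}R^{\top}$; $R^{\top}\mathbin{;}\overline{R\mathbin{;}S}\cup\overline{S}=\overline{S}$. The order is $R\subseteq S$ iff $R\cup S=S$; $R\cap S=\overline{\overline{R}\cup\overline{S}}$; $\mathsf{L}=R\cup\overline{R}$ is the greatest and $\mathsf{O}=R\cap\overline{R}$ the least element. The star satisfies $\mathsf{I}\cup R\mathbin{;}R^*\subseteq R^*$, $\mathsf{I}\cup R^*\mathbin{;}R\subseteq R^*$, $S\cup R\mathbin{;}Q\subseteq Q\Rightarrow R^*\mathbin{;}S\subseteq Q$, $S\cup Q\mathbin{;}R\subseteq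 Q\Rightarrow S\mathbin{;}R^*\subseteq Q$. Write $R^{\top*}=(R^{\top})^*$. The algebra satisfies the Tarski rule ($R\neq\mathsf{O}$ iff $\mathsf{L}\mathbin{;}R\mathbin{;}\mathsf{L}=\mathsf{L}$) and the point axiom (for every $R\neq\mathsf{O}$ there are points $p,q$ with $p\mathbin{;}q^{\top}\subseteq R$), where a point is an element $p$ with $p=p\mathbin{;}\mathsf{L}$, $p\mathbin{;}p^{\top}\subseteq\mathsf{I}$ and $\mathsf{I}\subseteq p^{\top}\mathbin{;}p$. Composition binds tighter than $\cup,\cap$; complement and converse bind tighter than composition. $R$ is univalent if $R^{\top}\mathbin{;}R\subseteq\mathsf{I}$ and injective if $R\mathbin{;}R^{\top}\subseteq\mathsf{I}$. $R$ is connected if $R\mathbin{;}\mathsf{L}\mathbin{;}R\subseteq R^*\cup R^{\top*}$; $R$ is a path if it is injective, univalent and connected. $\mathrm{sp}(R)=R\mathbin{;}\mathsf{L}\cap\overline{R^{\top}\mathbin{;}\mathsf{L}}$ and $\mathrm{ep}(R)=R^{\top}\mathbin{;}\mathsf{L}\cap\overline{R\mathbin{;}\mathsf{L}}$. A path $R$ is backward terminating if $\mathrm{sp}(R)\neq\mathsf{O}$ or $R=\mathsf{O}$; forward terminating if $\mathrm{ep}(R)\neq\mathsf{O}$ or $R=\mathsf{O}$; terminating if it is both backward and forward terminating. -}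

module Defs where

open import Data.Product using (Σ; _×_; _,_)
open import Data.Sum using (_⊎_)
open import Relation.Binary.PropositionalEquality using (_≡_)
open import Relation.Nullary using (¬_)
open import Function.Bundles using (_⇔_)

record KRAOps : Set₁ where
  infixl 20 _∪_
  infixl 30 _⨾_
  infix  40 ∁_
  infix  45 _ᵀ _⋆
  field
    Carrier : Set
    _∪_     : Carrier → Carrier → Carrier
    _⨾_     : Carrier → Carrier → Carrier
    ∁_      : Carrier → Carrier
    _ᵀ      : Carrier → Carrier
    _⋆      : Carrier → Carrier
    I       : Carrier

module Derived (K : KRAOps) where
  open KRAOps K public

  infix  10 _⊆_
  infixl 20 _∩_
  infix  45 _ᵀ⋆

  _⊆_ : Carrier → Carrier → Set
  R ⊆ S = R ∪ S ≡ S

  _∩_ : Carrier → Carrier → Carrier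
  R ∩ S = ∁ (∁ R ∪ ∁ S)

  -- L = R ∪ ∁R and O = R ∩ ∁R (independent of R by the axioms); we take R = I.
  L : Carrier
  L = I ∪ ∁ I

  O : Carrier
  O = I ∩ ∁ I

  _ᵀ⋆ : Carrier → Carrier
  R ᵀ⋆ = (R ᵀ) ⋆

  IsPoint : Carrier → Set
  IsPoint p = (p ≡ p ⨾ L) × (p ⨾ p ᵀ ⊆ I) × (I ⊆ p ᵀ ⨾ p)

  Univalent : Carrier → Set
  Univalent R = R ᵀ ⨾ R ⊆ I

  Injective : Carrier → Set
  Injective R = R ⨾ R ᵀ ⊆ I

  Connected : Carrier → Set
  Connected R = R ⨾ L ⨾ R ⊆ R ⋆ ∪ R ᵀ⋆

  IsPath : Carrier → Set
  IsPath R = Injective R × Univalent R × Connected R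

  sp : Carrier → Carrier
  sp R = R ⨾ L ∩ ∁ (R ᵀ ⨾ L)

  ep : Carrier → Carrier
  ep R = R ᵀ ⨾ L ∩ ∁ (R ⨾ L)

  BackwardTerminating : Carrier → Set
  BackwardTerminating R = ¬ (sp R ≡ O) ⊎ R ≡ O

  ForwardTerminating : Carrier → Set
  ForwardTerminating R = ¬ (ep R ≡ O) ⊎ R ≡ O

  Terminating : Carrier → Set
  Terminating R = BackwardTerminating R × ForwardTerminating R

record IsKRA (K : KRAOps) : Set where
  open Derived K
  field
    ∪-assoc  : ∀ R S T → (R ∪ S) ∪ T ≡ R ∪ (S ∪ T)
    ∪-comm   : ∀ R S → R ∪ S ≡ S ∪ R
    huntington : ∀ R S → R ≡ ∁ (∁ R ∪ ∁ S) ∪ ∁ (∁ R ∪ S)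
    ⨾-assoc  : ∀ R S T → (R ⨾ S) ⨾ T ≡ R ⨾ (S ⨾ T)
    ⨾-distribʳ-∪ : ∀ R S T → (R ∪ S) ⨾ T ≡ R ⨾ T ∪ S ⨾ T
    ⨾-identityʳ : ∀ R → R ⨾ I ≡ R
    ᵀ-involutive : ∀ R → (R ᵀ) ᵀ ≡ R
    ᵀ-distrib-∪  : ∀ R S → (R ∪ S) ᵀ ≡ R ᵀ ∪ S ᵀ
    ᵀ-distrib-⨾  : ∀ R S → (R ⨾ S) ᵀ ≡ S ᵀ ⨾ R ᵀ
    schröder     : ∀ R S → R ᵀ ⨾ ∁ (R ⨾ S) ∪ ∁ S ≡ ∁ S
    ⋆-unfoldˡ : ∀ R → I ∪ R ⨾ R ⋆ ⊆ R ⋆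
    ⋆-unfoldʳ : ∀ R → I ∪ R ⋆ ⨾ R ⊆ R ⋆
    ⋆-inductˡ : ∀ R S Q → S ∪ R ⨾ Q ⊆ Q → R ⋆ ⨾ S ⊆ Q
    ⋆-inductʳ : ∀ R S Q → S ∪ Q ⨾ R ⊆ Q → S ⨾ R ⋆ ⊆ Q
    tarski : ∀ R → (¬ (R ≡ O)) ⇔ (L ⨾ R ⨾ L ≡ L)
    point-axiom : ∀ R → ¬ (R ≡ O) →
      Σ Carrier (λ p → Σ Carrier (λ q → IsPoint p × IsPoint q × (p ⨾ q ᵀ ⊆ R)))

record KleeneRelationAlgebra : Set₁ where
  field
    ops   : KRAOps
    isKRA : IsKRA ops
  open Derived ops public
  open IsKRA isKRA public

-- By Schröder's law sp R = O iff the vector ∁(L⨾R)⨾R⨾L is O, and by the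
-- Tarski rule that vector is L otherwise; this gives (1) and (2). A start
-- point s has no predecessor, so connectivity forces s⨾R ⊆ R⋆: every edge lies
-- on the R-path leaving s, i.e. R ⊆ ∁(L⨾R)⨾R⋆, which is (3). Injectivity lets
-- one read that path backwards from any edge, giving (4); conversely, under (4)
-- a path without start points is disjoint from its own domain, hence empty.
-- Part (b) is (a) for the converse path, and (c) conjoins (a) and (b).

module Submission where

open import Defs
open import Axiom.ExcludedMiddle using (ExcludedMiddle)
open import Data.Empty using (⊥-elim)
open import Data.Product using (_×_; _,_)
open import Data.Product.Function.NonDependent.Propositional using (_×-⇔_)
open import Data.Sum using (_⊎_; inj₁; inj₂)
open import Data.Sum.Function.Propositional using (_⊎-⇔_)
open import Function.Base using (_∘_)
open import Function.Bundles using (_⇔_; mk⇔; Equivalence)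
import Function.Properties.Equivalence as ⇔
open import Level using (0ℓ)
open import Relation.Binary.Bundles using (Preorder)
open import Relation.Binary.PropositionalEquality
  using (_≡_; refl; sym; trans; cong; cong₂; subst; subst₂; isEquivalence; module ≡-Reasoning)
import Relation.Binary.Reasoning.Preorder as PreorderReasoning
open import Relation.Binary.Reasoning.Syntax using (module ⊆-syntax)
open import Relation.Nullary using (¬_; yes; no)

¬⊎⇔→ : ExcludedMiddle 0ℓ → ∀ {P Q : Set} → (¬ P ⊎ Q) ⇔ (P → Q)
¬⊎⇔→ em {P} {Q} = mk⇔ to from
  where
  to : ¬ P ⊎ Q → P → Q
  to (inj₁ ¬p) p = ⊥-elim (¬p p)
  to (inj₂ q)  _ = q
  from : (P → Q) → ¬ P ⊎ Q
  from p→q with em {P}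
  ... | yes p = inj₂ (p→q p)
  ... | no ¬p = inj₁ ¬p

×-⊎-factor : ∀ {P P′ Q : Set} → ((P ⊎ Q) × (P′ ⊎ Q)) ⇔ ((P × P′) ⊎ Q)
×-⊎-factor {P} {P′} {Q} = mk⇔ to from
  where
  to : (P ⊎ Q) × (P′ ⊎ Q) → (P × P′) ⊎ Q
  to (inj₁ p , inj₁ p′) = inj₁ (p , p′)
  to (inj₁ _ , inj₂ q)  = inj₂ q
  to (inj₂ q , _)       = inj₂ q
  from : (P × P′) ⊎ Q → (P ⊎ Q) × (P′ ⊎ Q)
  from (inj₁ (p , p′)) = inj₁ p , inj₁ p′
  from (inj₂ q)        = inj₂ q , inj₂ q

module KleeneRelationAlgebraProperties (A : KleeneRelationAlgebra) where
  open KleeneRelationAlgebra A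

  ᵀ-identity : I ᵀ ≡ I
  ᵀ-identity = begin
    I ᵀ               ≡⟨ sym (⨾-identityʳ (I ᵀ)) ⟩
    I ᵀ ⨾ I           ≡⟨ cong (I ᵀ ⨾_) (sym (ᵀ-involutive I)) ⟩
    I ᵀ ⨾ (I ᵀ) ᵀ     ≡⟨ sym (ᵀ-distrib-⨾ (I ᵀ) I) ⟩
    (I ᵀ ⨾ I) ᵀ       ≡⟨ cong _ᵀ (⨾-identityʳ (I ᵀ)) ⟩
    (I ᵀ) ᵀ           ≡⟨ ᵀ-involutive I ⟩
    I                 ∎
    where open ≡-Reasoning

  ⨾-identityˡ : ∀ S → I ⨾ S ≡ S
  ⨾-identityˡ S = begin
    I ⨾ S             ≡⟨ sym (ᵀ-involutive (I ⨾ S)) ⟩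
    ((I ⨾ S) ᵀ) ᵀ     ≡⟨ cong _ᵀ (ᵀ-distrib-⨾ I S) ⟩
    (S ᵀ ⨾ I ᵀ) ᵀ     ≡⟨ cong (λ i → (S ᵀ ⨾ i) ᵀ) ᵀ-identity ⟩
    (S ᵀ ⨾ I) ᵀ       ≡⟨ cong _ᵀ (⨾-identityʳ (S ᵀ)) ⟩
    (S ᵀ) ᵀ           ≡⟨ ᵀ-involutive S ⟩
    S                 ∎
    where open ≡-Reasoning

  -- Schröder's law at I yields idempotence of complements, sparing the
  -- long derivation of idempotence from Huntington's axiom alone.
  ∁-∪-idem : ∀ S → ∁ S ∪ ∁ S ≡ ∁ S
  ∁-∪-idem S = begin
    ∁ S ∪ ∁ S               ≡⟨ cong (_∪ ∁ S) (sym Iᵀ⨾∁I⨾S≡∁S) ⟩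
    I ᵀ ⨾ ∁ (I ⨾ S) ∪ ∁ S   ≡⟨ schröder I S ⟩
    ∁ S                     ∎
    where
    open ≡-Reasoning
    Iᵀ⨾∁I⨾S≡∁S : I ᵀ ⨾ ∁ (I ⨾ S) ≡ ∁ S
    Iᵀ⨾∁I⨾S≡∁S = trans (cong₂ (λ i s → i ⨾ ∁ s) ᵀ-identity (⨾-identityˡ S)) (⨾-identityˡ (∁ S))

  ∪-interchange : ∀ a b c d → (a ∪ b) ∪ (c ∪ d) ≡ (a ∪ c) ∪ (b ∪ d)
  ∪-interchange a b c d = begin
    (a ∪ b) ∪ (c ∪ d)   ≡⟨ ∪-assoc a b (c ∪ d) ⟩
    a ∪ (b ∪ (c ∪ d))   ≡⟨ cong (a ∪_) (sym (∪-assoc b c d)) ⟩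
    a ∪ ((b ∪ c) ∪ d)   ≡⟨ cong (λ x → a ∪ (x ∪ d)) (∪-comm b c) ⟩
    a ∪ ((c ∪ b) ∪ d)   ≡⟨ cong (a ∪_) (∪-assoc c b d) ⟩
    a ∪ (c ∪ (b ∪ d))   ≡⟨ sym (∪-assoc a c (b ∪ d)) ⟩
    (a ∪ c) ∪ (b ∪ d)   ∎
    where open ≡-Reasoning

  ∪-idem : ∀ x → x ∪ x ≡ x
  ∪-idem x = begin
    x ∪ x               ≡⟨ cong₂ _∪_ x≡a∪b x≡a∪b ⟩
    (a ∪ b) ∪ (a ∪ b)   ≡⟨ ∪-interchange a b a b ⟩
    (a ∪ a) ∪ (b ∪ b)   ≡⟨ cong₂ _∪_ (∁-∪-idem (∁ x ∪ ∁ x)) (∁-∪-idem (∁ x ∪ x)) ⟩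
    a ∪ b               ≡⟨ sym x≡a∪b ⟩
    x                   ∎
    where
    open ≡-Reasoning
    a = ∁ (∁ x ∪ ∁ x)
    b = ∁ (∁ x ∪ x)
    x≡a∪b : x ≡ a ∪ b
    x≡a∪b = huntington x x

  ⊆-refl : ∀ {x} → x ⊆ x
  ⊆-refl {x} = ∪-idem x

  ⊆-reflexive : ∀ {x y} → x ≡ y → x ⊆ y
  ⊆-reflexive refl = ⊆-refl

  ⊆-trans : ∀ {x y z} → x ⊆ y → y ⊆ z → x ⊆ z
  ⊆-trans {x} {y} {z} x⊆y y⊆z = begin
    x ∪ z         ≡⟨ cong (x ∪_) (sym y⊆z) ⟩
    x ∪ (y ∪ z)   ≡⟨ sym (∪-assoc x y z) ⟩
    (x ∪ y) ∪ z   ≡⟨ cong (_∪ z) x⊆y ⟩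
    y ∪ z         ≡⟨ y⊆z ⟩
    z             ∎
    where open ≡-Reasoning

  ⊆-antisym : ∀ {x y} → x ⊆ y → y ⊆ x → x ≡ y
  ⊆-antisym {x} {y} x⊆y y⊆x = trans (sym y⊆x) (trans (∪-comm y x) x⊆y)

  ⊆-preorder : Preorder _ _ _
  ⊆-preorder = record
    { Carrier    = Carrier
    ; _≈_        = _≡_
    ; _≲_        = _⊆_
    ; isPreorder = record
      { isEquivalence = isEquivalence
      ; reflexive     = ⊆-reflexive
      ; trans         = ⊆-trans
      }
    }

  module ⊆-Reasoning where
    open PreorderReasoning ⊆-preorder public
      hiding (step-≈; step-≈˘; step-≈-⟩; step-≈-⟨; step-≲; step-∼)
    open ⊆-syntax _IsRelatedTo_ _IsRelatedTo_ ≲-go public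

  open ⊆-Reasoning

  x⊆x∪y : ∀ {x y} → x ⊆ x ∪ y
  x⊆x∪y {x} {y} = trans (sym (∪-assoc x x y)) (cong (_∪ y) (∪-idem x))

  y⊆x∪y : ∀ {x y} → y ⊆ x ∪ y
  y⊆x∪y {x} {y} = subst (y ⊆_) (∪-comm y x) x⊆x∪y

  ∪-least : ∀ {x y z} → x ⊆ z → y ⊆ z → x ∪ y ⊆ z
  ∪-least {x} {y} {z} x⊆z y⊆z = trans (∪-assoc x y z) (trans (cong (x ∪_) y⊆z) x⊆z)

  ∪-mono : ∀ {a b c d} → a ⊆ b → c ⊆ d → a ∪ c ⊆ b ∪ d
  ∪-mono a⊆b c⊆d = ∪-least (⊆-trans a⊆b x⊆x∪y) (⊆-trans c⊆d y⊆x∪y)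

  ∁∁-⊆ : ∀ x → ∁ ∁ x ⊆ x
  ∁∁-⊆ x = begin
    ∁ ∁ x                         ⊆⟨ x⊆x∪y ⟩
    ∁ ∁ x ∪ ∁ (∁ x ∪ x)           ≡⟨ cong (λ y → ∁ y ∪ ∁ (∁ x ∪ x)) (sym (∁-∪-idem x)) ⟩
    ∁ (∁ x ∪ ∁ x) ∪ ∁ (∁ x ∪ x)   ≡⟨ sym (huntington x x) ⟩
    x                             ∎

  ∁-antitone : ∀ {a b} → a ⊆ b → ∁ b ⊆ ∁ a
  ∁-antitone {a} {b} a⊆b = begin
    ∁ b                               ⊆⟨ y⊆x∪y ⟩
    ∁ (∁ ∁ a ∪ ∁ b) ∪ ∁ b             ≡⟨ cong (λ y → ∁ (∁ ∁ a ∪ ∁ b) ∪ ∁ y) (sym (⊆-trans (∁∁-⊆ a) a⊆b)) ⟩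
    ∁ (∁ ∁ a ∪ ∁ b) ∪ ∁ (∁ ∁ a ∪ b)   ≡⟨ sym (huntington (∁ a) b) ⟩
    ∁ a                               ∎

  ∁-involutive : ∀ x → ∁ ∁ x ≡ x
  ∁-involutive x = begin-equality
    ∁ ∁ x                                 ≡⟨ huntington (∁ ∁ x) x ⟩
    ∁ (∁ ∁ ∁ x ∪ ∁ x) ∪ ∁ (∁ ∁ ∁ x ∪ x)   ≡⟨ cong (λ y → ∁ (y ∪ ∁ x) ∪ ∁ (y ∪ x)) ∁∁∁x≡∁x ⟩
    ∁ (∁ x ∪ ∁ x) ∪ ∁ (∁ x ∪ x)           ≡⟨ sym (huntington x x) ⟩
    x                                     ∎
    where
    ∁∁∁x≡∁x : ∁ ∁ ∁ x ≡ ∁ x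
    ∁∁∁x≡∁x = ⊆-antisym (∁∁-⊆ (∁ x)) (∁-antitone (∁∁-⊆ x))

  ⊆-∪-∁ : ∀ x y → y ⊆ x ∪ ∁ x
  ⊆-∪-∁ x y = begin
    y                             ≡⟨ huntington y x ⟩
    ∁ (∁ y ∪ ∁ x) ∪ ∁ (∁ y ∪ x)   ⊆⟨ ∪-mono (∁-antitone y⊆x∪y) (∁-antitone y⊆x∪y) ⟩
    ∁ ∁ x ∪ ∁ x                   ≡⟨ cong (_∪ ∁ x) (∁-involutive x) ⟩
    x ∪ ∁ x                       ∎

  ⊆-L : ∀ {y} → y ⊆ L
  ⊆-L {y} = ⊆-∪-∁ I y

  O≡∁L : O ≡ ∁ L
  O≡∁L = cong ∁_ (trans (cong (∁ I ∪_) (∁-involutive I)) (∪-comm (∁ I) I))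

  ∁O≡L : ∁ O ≡ L
  ∁O≡L = trans (cong ∁_ O≡∁L) (∁-involutive L)

  O-least : ∀ {y} → O ⊆ y
  O-least {y} = begin
    O       ≡⟨ O≡∁L ⟩
    ∁ L     ⊆⟨ ∁-antitone ⊆-L ⟩
    ∁ ∁ y   ≡⟨ ∁-involutive y ⟩
    y       ∎

  ⊆O⇒≡O : ∀ {x} → x ⊆ O → x ≡ O
  ⊆O⇒≡O x⊆O = ⊆-antisym x⊆O O-least

  x∩y⊆x : ∀ {x y} → x ∩ y ⊆ x
  x∩y⊆x {x} {y} = subst (x ∩ y ⊆_) (∁-involutive x) (∁-antitone x⊆x∪y)

  x∩y⊆y : ∀ {x y} → x ∩ y ⊆ y
  x∩y⊆y {x} {y} = subst (x ∩ y ⊆_) (∁-involutive y) (∁-antitone y⊆x∪y)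

  ∩-greatest : ∀ {x y z} → z ⊆ x → z ⊆ y → z ⊆ x ∩ y
  ∩-greatest {z = z} z⊆x z⊆y = subst (_⊆ _) (∁-involutive z) (∁-antitone (∪-least (∁-antitone z⊆x) (∁-antitone z⊆y)))

  ∩-comm : ∀ x y → x ∩ y ≡ y ∩ x
  ∩-comm x y = cong ∁_ (∪-comm (∁ x) (∁ y))

  ∩-mono : ∀ {a b c d} → a ⊆ b → c ⊆ d → a ∩ c ⊆ b ∩ d
  ∩-mono a⊆b c⊆d = ∩-greatest (⊆-trans x∩y⊆x a⊆b) (⊆-trans x∩y⊆y c⊆d)

  ∩-∁⊆O : ∀ x → x ∩ ∁ x ⊆ O
  ∩-∁⊆O x = begin
    ∁ (∁ x ∪ ∁ ∁ x)   ⊆⟨ ∁-antitone (⊆-∪-∁ (∁ x) L) ⟩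
    ∁ L               ≡⟨ sym O≡∁L ⟩
    O                 ∎

  ⊆-∁-contradiction : ∀ {r a} → r ⊆ a → r ⊆ ∁ a → r ⊆ O
  ⊆-∁-contradiction r⊆a r⊆∁a = ⊆-trans (∩-greatest r⊆a r⊆∁a) (∩-∁⊆O _)

  ∩-∁-split : ∀ x y → x ≡ (x ∩ y) ∪ (x ∩ ∁ y)
  ∩-∁-split x y = trans (huntington x y) (cong (λ z → x ∩ y ∪ ∁ (∁ x ∪ z)) (sym (∁-involutive y)))

  ∩⊆O⇒⊆∁ : ∀ {a b} → a ∩ b ⊆ O → a ⊆ ∁ b
  ∩⊆O⇒⊆∁ {a} {b} a∩b⊆O = begin
    a                 ≡⟨ ∩-∁-split a b ⟩
    (a ∩ b) ∪ (a ∩ ∁ b)   ⊆⟨ ∪-least (⊆-trans a∩b⊆O O-least) x∩y⊆y ⟩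
    ∁ b               ∎

  ∁-∪ : ∀ y z → ∁ (y ∪ z) ≡ ∁ y ∩ ∁ z
  ∁-∪ y z = cong ∁_ (sym (cong₂ _∪_ (∁-involutive y) (∁-involutive z)))

  ∩-distribˡ-∪ : ∀ x y z → x ∩ (y ∪ z) ⊆ (x ∩ y) ∪ (x ∩ z)
  ∩-distribˡ-∪ x y z = begin
    q                 ≡⟨ ∩-∁-split q m ⟩
    (q ∩ m) ∪ (q ∩ ∁ m)   ⊆⟨ ∪-least x∩y⊆y (⊆-trans q∩∁m⊆O O-least) ⟩
    m                 ∎
    where
    m = (x ∩ y) ∪ (x ∩ z)
    q = x ∩ (y ∪ z)
    p = q ∩ ∁ m
    ⊆∁-of-∁x∩ : ∀ {w} → p ⊆ ∁ (x ∩ w) → p ⊆ ∁ w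
    ⊆∁-of-∁x∩ p⊆∁x∩w = ∩⊆O⇒⊆∁ (⊆-∁-contradiction (∩-mono (⊆-trans x∩y⊆x x∩y⊆x) ⊆-refl) (⊆-trans x∩y⊆x p⊆∁x∩w))
    q∩∁m⊆O : p ⊆ O
    q∩∁m⊆O = ⊆-∁-contradiction (⊆-trans x∩y⊆x x∩y⊆y) (begin
      p                 ⊆⟨ ∩-greatest (⊆∁-of-∁x∩ (⊆-trans x∩y⊆y (∁-antitone x⊆x∪y)))
                                      (⊆∁-of-∁x∩ (⊆-trans x∩y⊆y (∁-antitone y⊆x∪y))) ⟩
      ∁ y ∩ ∁ z         ≡⟨ sym (∁-∪ y z) ⟩
      ∁ (y ∪ z)         ∎)

  ⊆∪⇒⊆ʳ : ∀ {r a b} → r ⊆ a ∪ b → r ∩ a ⊆ O → r ⊆ b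
  ⊆∪⇒⊆ʳ {r} {a} {b} r⊆a∪b r∩a⊆O = begin
    r                   ⊆⟨ ∩-greatest ⊆-refl r⊆a∪b ⟩
    r ∩ (a ∪ b)         ⊆⟨ ∩-distribˡ-∪ r a b ⟩
    (r ∩ a) ∪ (r ∩ b)   ⊆⟨ ∪-least (⊆-trans r∩a⊆O O-least) x∩y⊆y ⟩
    b                   ∎

  ⊆∪⇒⊆ˡ : ∀ {r a b} → r ⊆ a ∪ b → r ∩ b ⊆ O → r ⊆ a
  ⊆∪⇒⊆ˡ {r} {a} {b} r⊆a∪b = ⊆∪⇒⊆ʳ (subst (r ⊆_) (∪-comm a b) r⊆a∪b)

  ⨾-distribˡ-∪ : ∀ R S T → R ⨾ (S ∪ T) ≡ R ⨾ S ∪ R ⨾ T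
  ⨾-distribˡ-∪ R S T = begin-equality
    R ⨾ (S ∪ T)                     ≡⟨ sym (ᵀ-involutive _) ⟩
    ((R ⨾ (S ∪ T)) ᵀ) ᵀ             ≡⟨ cong _ᵀ (ᵀ-distrib-⨾ R (S ∪ T)) ⟩
    ((S ∪ T) ᵀ ⨾ R ᵀ) ᵀ             ≡⟨ cong (λ X → (X ⨾ R ᵀ) ᵀ) (ᵀ-distrib-∪ S T) ⟩
    ((S ᵀ ∪ T ᵀ) ⨾ R ᵀ) ᵀ           ≡⟨ cong _ᵀ (⨾-distribʳ-∪ (S ᵀ) (T ᵀ) (R ᵀ)) ⟩
    (S ᵀ ⨾ R ᵀ ∪ T ᵀ ⨾ R ᵀ) ᵀ       ≡⟨ ᵀ-distrib-∪ _ _ ⟩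
    (S ᵀ ⨾ R ᵀ) ᵀ ∪ (T ᵀ ⨾ R ᵀ) ᵀ   ≡⟨ cong₂ _∪_ (ᵀ-distrib-⨾-ᵀ S) (ᵀ-distrib-⨾-ᵀ T) ⟩
    R ⨾ S ∪ R ⨾ T                   ∎
    where
    ᵀ-distrib-⨾-ᵀ : ∀ X → (X ᵀ ⨾ R ᵀ) ᵀ ≡ R ⨾ X
    ᵀ-distrib-⨾-ᵀ X = trans (ᵀ-distrib-⨾ (X ᵀ) (R ᵀ)) (cong₂ _⨾_ (ᵀ-involutive R) (ᵀ-involutive X))

  ⨾-monoʳ : ∀ {R S T} → S ⊆ T → R ⨾ S ⊆ R ⨾ T
  ⨾-monoʳ {R} {S} {T} S⊆T = trans (sym (⨾-distribˡ-∪ R S T)) (cong (R ⨾_) S⊆T)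

  ⨾-monoˡ : ∀ {R S T} → S ⊆ T → S ⨾ R ⊆ T ⨾ R
  ⨾-monoˡ {R} {S} {T} S⊆T = trans (sym (⨾-distribʳ-∪ S T R)) (cong (_⨾ R) S⊆T)

  ⨾-mono : ∀ {a b c d} → a ⊆ b → c ⊆ d → a ⨾ c ⊆ b ⨾ d
  ⨾-mono a⊆b c⊆d = ⊆-trans (⨾-monoˡ a⊆b) (⨾-monoʳ c⊆d)

  ᵀ-mono : ∀ {S T} → S ⊆ T → S ᵀ ⊆ T ᵀ
  ᵀ-mono {S} {T} S⊆T = trans (sym (ᵀ-distrib-∪ S T)) (cong _ᵀ S⊆T)

  ᵀ-mono⁻¹ : ∀ {S T} → S ᵀ ⊆ T ᵀ → S ⊆ T
  ᵀ-mono⁻¹ {S} {T} Sᵀ⊆Tᵀ = subst₂ _⊆_ (ᵀ-involutive S) (ᵀ-involutive T) (ᵀ-mono Sᵀ⊆Tᵀ)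

  ᵀ⊆⇒⊆ᵀ : ∀ {S T} → S ᵀ ⊆ T → S ⊆ T ᵀ
  ᵀ⊆⇒⊆ᵀ {S} Sᵀ⊆T = subst (_⊆ _) (ᵀ-involutive S) (ᵀ-mono Sᵀ⊆T)

  ⊆ᵀ⇒ᵀ⊆ : ∀ {S T} → S ⊆ T ᵀ → S ᵀ ⊆ T
  ⊆ᵀ⇒ᵀ⊆ {T = T} S⊆Tᵀ = subst (_ ⊆_) (ᵀ-involutive T) (ᵀ-mono S⊆Tᵀ)

  ᵀ-L : L ᵀ ≡ L
  ᵀ-L = ⊆-antisym ⊆-L (ᵀ⊆⇒⊆ᵀ ⊆-L)

  ᵀ-O : O ᵀ ≡ O
  ᵀ-O = ⊆-antisym (⊆ᵀ⇒ᵀ⊆ O-least) O-least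

  ᵀ-distrib-∩ : ∀ x y → (x ∩ y) ᵀ ≡ x ᵀ ∩ y ᵀ
  ᵀ-distrib-∩ x y = ⊆-antisym (∩-greatest (ᵀ-mono x∩y⊆x) (ᵀ-mono x∩y⊆y))
                              (ᵀ⊆⇒⊆ᵀ (∩-greatest (⊆ᵀ⇒ᵀ⊆ x∩y⊆x) (⊆ᵀ⇒ᵀ⊆ x∩y⊆y)))

  ∁-unique : ∀ {a b} → L ⊆ a ∪ b → a ∩ b ⊆ O → b ≡ ∁ a
  ∁-unique {a} {b} L⊆a∪b a∩b⊆O = ⊆-antisym (∩⊆O⇒⊆∁ (subst (_⊆ O) (∩-comm a b) a∩b⊆O)) (begin
    ∁ a                         ≡⟨ ∩-∁-split (∁ a) b ⟩
    (∁ a ∩ b) ∪ (∁ a ∩ ∁ b)     ⊆⟨ ∪-least x∩y⊆y (⊆-trans ∁a∩∁b⊆O O-least) ⟩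
    b                           ∎)
    where
    ∁a∩∁b⊆O : ∁ a ∩ ∁ b ⊆ O
    ∁a∩∁b⊆O = begin
      ∁ a ∩ ∁ b   ≡⟨ sym (∁-∪ a b) ⟩
      ∁ (a ∪ b)   ⊆⟨ ∁-antitone L⊆a∪b ⟩
      ∁ L         ≡⟨ sym O≡∁L ⟩
      O           ∎

  ᵀ-distrib-∁ : ∀ x → (∁ x) ᵀ ≡ ∁ (x ᵀ)
  ᵀ-distrib-∁ x = ∁-unique
    (subst₂ _⊆_ ᵀ-L (ᵀ-distrib-∪ x (∁ x)) (ᵀ-mono (⊆-∪-∁ x L)))
    (subst₂ _⊆_ (ᵀ-distrib-∩ x (∁ x)) ᵀ-O (ᵀ-mono (∩-∁⊆O x)))

  schröderˡ : ∀ {Q S T} → Q ⨾ S ⊆ T → Q ᵀ ⨾ ∁ T ⊆ ∁ S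
  schröderˡ {Q} {S} {T} Q⨾S⊆T = ⊆-trans (⨾-monoʳ (∁-antitone Q⨾S⊆T)) (schröder Q S)

  schröderˡ⁻¹ : ∀ {Q S T} → Q ᵀ ⨾ ∁ T ⊆ ∁ S → Q ⨾ S ⊆ T
  schröderˡ⁻¹ {Q} {S} {T} h = subst₂ _⊆_ (cong₂ _⨾_ (ᵀ-involutive Q) (∁-involutive S)) (∁-involutive T) (schröderˡ h)

  schröderʳ : ∀ {Q S T} → Q ⨾ S ⊆ T → ∁ T ⨾ S ᵀ ⊆ ∁ Q
  schröderʳ {Q} {S} {T} Q⨾S⊆T = ᵀ-mono⁻¹ (begin
    (∁ T ⨾ S ᵀ) ᵀ           ≡⟨ ᵀ-distrib-⨾ (∁ T) (S ᵀ) ⟩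
    (S ᵀ) ᵀ ⨾ (∁ T) ᵀ       ≡⟨ cong ((S ᵀ) ᵀ ⨾_) (ᵀ-distrib-∁ T) ⟩
    (S ᵀ) ᵀ ⨾ ∁ (T ᵀ)       ⊆⟨ schröderˡ (subst (_⊆ T ᵀ) (ᵀ-distrib-⨾ Q S) (ᵀ-mono Q⨾S⊆T)) ⟩
    ∁ (Q ᵀ)                 ≡⟨ sym (ᵀ-distrib-∁ Q) ⟩
    (∁ Q) ᵀ                 ∎)

  L⨾L≡L : L ⨾ L ≡ L
  L⨾L≡L = ⊆-antisym ⊆-L (subst (_⊆ L ⨾ L) (⨾-identityˡ L) (⨾-monoˡ ⊆-L))

  ⊆-⨾L : ∀ {X} → X ⊆ X ⨾ L
  ⊆-⨾L {X} = subst (_⊆ X ⨾ L) (⨾-identityʳ X) (⨾-monoʳ ⊆-L)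

  ⊆-L⨾ : ∀ {X} → X ⊆ L ⨾ X
  ⊆-L⨾ {X} = subst (_⊆ L ⨾ X) (⨾-identityˡ X) (⨾-monoˡ ⊆-L)

  ⨾O⊆O : ∀ {X} → X ⨾ O ⊆ O
  ⨾O⊆O = ⊆-trans (⨾-monoˡ ⊆-L) (schröderˡ⁻¹ (subst (L ᵀ ⨾ ∁ O ⊆_) (sym ∁O≡L) ⊆-L))

  O⨾⊆O : ∀ {X} → O ⨾ X ⊆ O
  O⨾⊆O {X} = ᵀ-mono⁻¹ (begin
    (O ⨾ X) ᵀ     ≡⟨ ᵀ-distrib-⨾ O X ⟩
    X ᵀ ⨾ O ᵀ     ≡⟨ cong (X ᵀ ⨾_) ᵀ-O ⟩
    X ᵀ ⨾ O       ⊆⟨ ⨾O⊆O ⟩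
    O             ≡⟨ sym ᵀ-O ⟩
    O ᵀ           ∎)

  dedekindˡ : ∀ Q S T → Q ⨾ S ∩ T ⊆ (Q ∩ T ⨾ S ᵀ) ⨾ S
  dedekindˡ Q S T = ⊆∪⇒⊆ˡ Q⨾S∩T⊆ (⊆-∁-contradiction (⊆-trans x∩y⊆x x∩y⊆y) (⊆-trans x∩y⊆y [Q∩∁W]⨾S⊆∁T))
    where
    W = T ⨾ S ᵀ
    Q⨾S∩T⊆ : Q ⨾ S ∩ T ⊆ (Q ∩ W) ⨾ S ∪ (Q ∩ ∁ W) ⨾ S
    Q⨾S∩T⊆ = begin
      Q ⨾ S ∩ T                       ⊆⟨ x∩y⊆x ⟩
      Q ⨾ S                           ≡⟨ cong (_⨾ S) (∩-∁-split Q W) ⟩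
      ((Q ∩ W) ∪ (Q ∩ ∁ W)) ⨾ S       ≡⟨ ⨾-distribʳ-∪ (Q ∩ W) (Q ∩ ∁ W) S ⟩
      (Q ∩ W) ⨾ S ∪ (Q ∩ ∁ W) ⨾ S     ∎
    [Q∩∁W]⨾S⊆∁T : (Q ∩ ∁ W) ⨾ S ⊆ ∁ T
    [Q∩∁W]⨾S⊆∁T = begin
      (Q ∩ ∁ W) ⨾ S   ⊆⟨ ⨾-monoˡ x∩y⊆y ⟩
      ∁ W ⨾ S         ≡⟨ cong (∁ W ⨾_) (sym (ᵀ-involutive S)) ⟩
      ∁ W ⨾ (S ᵀ) ᵀ   ⊆⟨ schröderʳ ⊆-refl ⟩
      ∁ T             ∎

  dedekindʳ : ∀ Q S T → Q ⨾ S ∩ T ⊆ Q ⨾ (S ∩ Q ᵀ ⨾ T)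
  dedekindʳ Q S T = ᵀ-mono⁻¹ (begin
    (Q ⨾ S ∩ T) ᵀ                   ≡⟨ ᵀ-distrib-∩ (Q ⨾ S) T ⟩
    (Q ⨾ S) ᵀ ∩ T ᵀ                 ≡⟨ cong (_∩ T ᵀ) (ᵀ-distrib-⨾ Q S) ⟩
    S ᵀ ⨾ Q ᵀ ∩ T ᵀ                 ⊆⟨ dedekindˡ (S ᵀ) (Q ᵀ) (T ᵀ) ⟩
    (S ᵀ ∩ T ᵀ ⨾ (Q ᵀ) ᵀ) ⨾ Q ᵀ     ≡⟨ cong (λ X → (S ᵀ ∩ X) ⨾ Q ᵀ) (sym (ᵀ-distrib-⨾ (Q ᵀ) T)) ⟩
    (S ᵀ ∩ (Q ᵀ ⨾ T) ᵀ) ⨾ Q ᵀ       ≡⟨ cong (_⨾ Q ᵀ) (sym (ᵀ-distrib-∩ S (Q ᵀ ⨾ T))) ⟩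
    (S ∩ Q ᵀ ⨾ T) ᵀ ⨾ Q ᵀ           ≡⟨ sym (ᵀ-distrib-⨾ Q (S ∩ Q ᵀ ⨾ T)) ⟩
    (Q ⨾ (S ∩ Q ᵀ ⨾ T)) ᵀ           ∎)

  ⊆I⇒⊆ᵀ : ∀ {p} → p ⊆ I → p ⊆ p ᵀ
  ⊆I⇒⊆ᵀ {p} p⊆I = begin
    p                     ⊆⟨ ∩-greatest (⊆-reflexive (sym (⨾-identityˡ p))) p⊆I ⟩
    I ⨾ p ∩ I             ⊆⟨ dedekindˡ I p I ⟩
    (I ∩ I ⨾ p ᵀ) ⨾ p     ⊆⟨ ⨾-monoˡ x∩y⊆y ⟩
    (I ⨾ p ᵀ) ⨾ p         ≡⟨ cong (_⨾ p) (⨾-identityˡ (p ᵀ)) ⟩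
    p ᵀ ⨾ p               ⊆⟨ ⨾-monoʳ p⊆I ⟩
    p ᵀ ⨾ I               ≡⟨ ⨾-identityʳ (p ᵀ) ⟩
    p ᵀ                   ∎

  ⋆⊆I∪⨾⋆ : ∀ {R} → R ⋆ ⊆ I ∪ R ⨾ R ⋆
  ⋆⊆I∪⨾⋆ {R} = subst (_⊆ I ∪ R ⨾ R ⋆) (⨾-identityʳ (R ⋆))
    (⋆-inductˡ R I (I ∪ R ⨾ R ⋆) (∪-mono ⊆-refl (⨾-monoʳ (⋆-unfoldˡ R))))

  ⋆⊆I∪⋆⨾ : ∀ {R} → R ⋆ ⊆ I ∪ R ⋆ ⨾ R
  ⋆⊆I∪⋆⨾ {R} = subst (_⊆ I ∪ R ⋆ ⨾ R) (⨾-identityˡ (R ⋆))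
    (⋆-inductʳ R I (I ∪ R ⋆ ⨾ R) (∪-mono ⊆-refl (⨾-monoˡ (⋆-unfoldʳ R))))

  ᵀ⋆⊆⋆ᵀ : ∀ R → R ᵀ⋆ ⊆ (R ⋆) ᵀ
  ᵀ⋆⊆⋆ᵀ R = subst (_⊆ (R ⋆) ᵀ) (⨾-identityʳ (R ᵀ⋆)) (⋆-inductˡ (R ᵀ) I ((R ⋆) ᵀ) (begin
    I ∪ R ᵀ ⨾ (R ⋆) ᵀ       ≡⟨ cong₂ _∪_ (sym ᵀ-identity) (sym (ᵀ-distrib-⨾ (R ⋆) R)) ⟩
    I ᵀ ∪ (R ⋆ ⨾ R) ᵀ       ≡⟨ sym (ᵀ-distrib-∪ I (R ⋆ ⨾ R)) ⟩
    (I ∪ R ⋆ ⨾ R) ᵀ         ⊆⟨ ᵀ-mono (⋆-unfoldʳ R) ⟩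
    (R ⋆) ᵀ                 ∎))

  ᵀ-⋆ : ∀ R → (R ⋆) ᵀ ≡ R ᵀ⋆
  ᵀ-⋆ R = ⊆-antisym (⊆ᵀ⇒ᵀ⊆ (subst (λ X → X ⋆ ⊆ (R ᵀ⋆) ᵀ) (ᵀ-involutive R) (ᵀ⋆⊆⋆ᵀ (R ᵀ)))) (ᵀ⋆⊆⋆ᵀ R)

  ∁[⨾L]⨾L⊆∁[⨾L] : ∀ Y → ∁ (Y ⨾ L) ⨾ L ⊆ ∁ (Y ⨾ L)
  ∁[⨾L]⨾L⊆∁[⨾L] Y = subst (λ X → ∁ (Y ⨾ L) ⨾ X ⊆ ∁ (Y ⨾ L)) ᵀ-L
    (schröderʳ (⊆-reflexive (trans (⨾-assoc Y L L) (cong (Y ⨾_) L⨾L≡L))))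

  L⨾∁[L⨾]⊆∁[L⨾] : ∀ Y → L ⨾ ∁ (L ⨾ Y) ⊆ ∁ (L ⨾ Y)
  L⨾∁[L⨾]⊆∁[L⨾] Y = subst (λ X → X ⨾ ∁ (L ⨾ Y) ⊆ ∁ (L ⨾ Y)) ᵀ-L
    (schröderˡ (⊆-reflexive (trans (sym (⨾-assoc L L Y)) (cong (_⨾ Y) L⨾L≡L))))

  ᵀ-∁[⨾L] : ∀ Y → (∁ (Y ⨾ L)) ᵀ ≡ ∁ (L ⨾ Y ᵀ)
  ᵀ-∁[⨾L] Y = trans (ᵀ-distrib-∁ (Y ⨾ L)) (cong ∁_ (trans (ᵀ-distrib-⨾ Y L) (cong (_⨾ Y ᵀ) ᵀ-L)))

  ᵀ-∁[L⨾] : ∀ Y → (∁ (L ⨾ Y)) ᵀ ≡ ∁ (Y ᵀ ⨾ L)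
  ᵀ-∁[L⨾] Y = trans (ᵀ-distrib-∁ (L ⨾ Y)) (cong ∁_ (trans (ᵀ-distrib-⨾ L Y) (cong (Y ᵀ ⨾_) ᵀ-L)))

  ⨾-distribʳ-∩ : ∀ a b c → (a ∩ b) ⨾ c ⊆ a ⨾ c ∩ b ⨾ c
  ⨾-distribʳ-∩ a b c = ∩-greatest (⨾-monoˡ x∩y⊆x) (⨾-monoˡ x∩y⊆y)

  tarski-≡L : ∀ {Y Z} → ¬ Y ≡ O → L ⨾ Y ⨾ L ⊆ Z → Z ≡ L
  tarski-≡L {Y} {Z} Y≢O L⨾Y⨾L⊆Z = ⊆-antisym ⊆-L (begin
    L           ≡⟨ sym (Equivalence.to (tarski Y) Y≢O) ⟩
    L ⨾ Y ⨾ L   ⊆⟨ L⨾Y⨾L⊆Z ⟩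
    Z           ∎)

  sp⨾⊆sp : ∀ R Z → sp R ⨾ Z ⊆ sp R
  sp⨾⊆sp R Z = begin
    sp R ⨾ Z                                ⊆⟨ ⨾-monoʳ ⊆-L ⟩
    (R ⨾ L ∩ ∁ (R ᵀ ⨾ L)) ⨾ L               ⊆⟨ ⨾-distribʳ-∩ (R ⨾ L) (∁ (R ᵀ ⨾ L)) L ⟩
    R ⨾ L ⨾ L ∩ ∁ (R ᵀ ⨾ L) ⨾ L             ⊆⟨ ∩-mono (⊆-reflexive (trans (⨾-assoc R L L) (cong (R ⨾_) L⨾L≡L)))
                                                      (∁[⨾L]⨾L⊆∁[⨾L] (R ᵀ)) ⟩
    sp R                                    ∎

  sp∩⊆O : ∀ {R X} → X ⊆ R ᵀ ⨾ L → sp R ∩ X ⊆ O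
  sp∩⊆O X⊆Rᵀ⨾L = ⊆-∁-contradiction (⊆-trans x∩y⊆y X⊆Rᵀ⨾L) (⊆-trans x∩y⊆x x∩y⊆y)

  spᵀ⊆∁[L⨾R] : ∀ R → sp R ᵀ ⊆ ∁ (L ⨾ R)
  spᵀ⊆∁[L⨾R] R = begin
    sp R ᵀ                ⊆⟨ ᵀ-mono x∩y⊆y ⟩
    (∁ (R ᵀ ⨾ L)) ᵀ       ≡⟨ ᵀ-∁[⨾L] (R ᵀ) ⟩
    ∁ (L ⨾ (R ᵀ) ᵀ)       ≡⟨ cong (λ X → ∁ (L ⨾ X)) (ᵀ-involutive R) ⟩
    ∁ (L ⨾ R)             ∎

  sp≢O⇒spᵀ⨾L≡L : ∀ R → ¬ sp R ≡ O → sp R ᵀ ⨾ L ≡ L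
  sp≢O⇒spᵀ⨾L≡L R sp≢O = begin-equality
    sp R ᵀ ⨾ L        ≡⟨ cong (sp R ᵀ ⨾_) (sym ᵀ-L) ⟩
    sp R ᵀ ⨾ L ᵀ      ≡⟨ sym (ᵀ-distrib-⨾ L (sp R)) ⟩
    (L ⨾ sp R) ᵀ      ≡⟨ cong _ᵀ L⨾sp≡L ⟩
    L ᵀ               ≡⟨ ᵀ-L ⟩
    L                 ∎
    where
    L⨾sp≡L : L ⨾ sp R ≡ L
    L⨾sp≡L = tarski-≡L sp≢O (⊆-trans (⊆-reflexive (⨾-assoc L (sp R) L)) (⨾-monoʳ (sp⨾⊆sp R L)))

  sp⨾R⊆⋆ : ∀ {R} → Connected R → sp R ⨾ R ⊆ R ⋆
  sp⨾R⊆⋆ {R} connected = ⊆∪⇒⊆ˡ sp⨾R⊆ (begin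
    sp R ⨾ R ∩ (I ∪ R ᵀ ⨾ R ᵀ⋆)                    ⊆⟨ ∩-distribˡ-∪ (sp R ⨾ R) I (R ᵀ ⨾ R ᵀ⋆) ⟩
    (sp R ⨾ R ∩ I) ∪ (sp R ⨾ R ∩ R ᵀ ⨾ R ᵀ⋆)       ⊆⟨ ∪-least sp⨾R∩I⊆O sp⨾R∩Rᵀ⨾⊆O ⟩
    O                                              ∎)
    where
    sp⨾R⊆ : sp R ⨾ R ⊆ R ⋆ ∪ (I ∪ R ᵀ ⨾ R ᵀ⋆)
    sp⨾R⊆ = begin
      sp R ⨾ R                      ⊆⟨ ⨾-monoˡ x∩y⊆x ⟩
      R ⨾ L ⨾ R                     ⊆⟨ connected ⟩
      R ⋆ ∪ R ᵀ⋆                    ⊆⟨ ∪-mono ⊆-refl ⋆⊆I∪⨾⋆ ⟩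
      R ⋆ ∪ (I ∪ R ᵀ ⨾ R ᵀ⋆)        ∎
    sp⨾R∩I⊆O : sp R ⨾ R ∩ I ⊆ O
    sp⨾R∩I⊆O = begin
      sp R ⨾ R ∩ I              ⊆⟨ dedekindˡ (sp R) R I ⟩
      (sp R ∩ I ⨾ R ᵀ) ⨾ R      ⊆⟨ ⨾-monoˡ (sp∩⊆O (⊆-trans (⊆-reflexive (⨾-identityˡ (R ᵀ))) ⊆-⨾L)) ⟩
      O ⨾ R                     ⊆⟨ O⨾⊆O ⟩
      O                         ∎
    sp⨾R∩Rᵀ⨾⊆O : sp R ⨾ R ∩ R ᵀ ⨾ R ᵀ⋆ ⊆ O
    sp⨾R∩Rᵀ⨾⊆O = ⊆-trans (∩-mono (sp⨾⊆sp R R) ⊆-refl) (sp∩⊆O (⨾-monoʳ ⊆-L))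

  sp≡O⇔∁[Rᵀ⨾L]⨾L⊆∁R : ∀ R → (sp R ≡ O) ⇔ (∁ (R ᵀ ⨾ L) ⨾ L ⊆ ∁ R)
  sp≡O⇔∁[Rᵀ⨾L]⨾L⊆∁R R = mk⇔ to from
    where
    n = ∁ (R ᵀ ⨾ L)
    to : sp R ≡ O → n ⨾ L ⊆ ∁ R
    to sp≡O = subst₂ (λ a b → a ⨾ b ⊆ ∁ R) (∁-involutive n) ᵀ-L (schröderʳ (∩⊆O⇒⊆∁ (⊆-reflexive sp≡O)))
    from : n ⨾ L ⊆ ∁ R → sp R ≡ O
    from n⨾L⊆∁R = ⊆O⇒≡O (begin
      R ⨾ L ∩ n             ⊆⟨ dedekindˡ R L n ⟩
      (R ∩ n ⨾ L ᵀ) ⨾ L     ≡⟨ cong (λ X → (R ∩ n ⨾ X) ⨾ L) ᵀ-L ⟩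
      (R ∩ n ⨾ L) ⨾ L       ⊆⟨ ⨾-monoˡ (⊆-∁-contradiction x∩y⊆x (⊆-trans x∩y⊆y n⨾L⊆∁R)) ⟩
      O ⨾ L                 ⊆⟨ O⨾⊆O ⟩
      O                     ∎)

  ∁[L⨾R]⨾R⨾L≡O⇔∁[Rᵀ⨾L]⨾L⊆∁R : ∀ R → (∁ (L ⨾ R) ⨾ R ⨾ L ≡ O) ⇔ (∁ (R ᵀ ⨾ L) ⨾ L ⊆ ∁ R)
  ∁[L⨾R]⨾R⨾L≡O⇔∁[Rᵀ⨾L]⨾L⊆∁R R = mk⇔ to from
    where
    to : ∁ (L ⨾ R) ⨾ R ⨾ L ≡ O → ∁ (R ᵀ ⨾ L) ⨾ L ⊆ ∁ R
    to X≡O = subst₂ (λ a b → a ⨾ b ⊆ ∁ R) (ᵀ-∁[L⨾] R) (∁-involutive L)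
      (schröderˡ (⊆-trans ⊆-⨾L (⊆-reflexive (trans X≡O O≡∁L))))
    from : ∁ (R ᵀ ⨾ L) ⨾ L ⊆ ∁ R → ∁ (L ⨾ R) ⨾ R ⨾ L ≡ O
    from h = ⊆O⇒≡O (⊆-trans (⨾-monoˡ (schröderˡ⁻¹ (subst₂ (λ a b → a ⨾ b ⊆ ∁ R) (sym (ᵀ-∁[L⨾] R)) (sym ∁O≡L) h))) O⨾⊆O)

  sp≡O⇔∁[L⨾R]⨾R⨾L≡O : ∀ R → (sp R ≡ O) ⇔ (∁ (L ⨾ R) ⨾ R ⨾ L ≡ O)
  sp≡O⇔∁[L⨾R]⨾R⨾L≡O R = ⇔.trans (sp≡O⇔∁[Rᵀ⨾L]⨾L⊆∁R R) (⇔.sym (∁[L⨾R]⨾R⨾L≡O⇔∁[Rᵀ⨾L]⨾L⊆∁R R))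

  L⨾∁[L⨾R]⨾R⨾L⨾L⊆ : ∀ R → L ⨾ (∁ (L ⨾ R) ⨾ R ⨾ L) ⨾ L ⊆ ∁ (L ⨾ R) ⨾ R ⨾ L
  L⨾∁[L⨾R]⨾R⨾L⨾L⊆ R = begin
    L ⨾ (nT ⨾ R ⨾ L) ⨾ L      ≡⟨ cong (_⨾ L) (sym (⨾-assoc L (nT ⨾ R) L)) ⟩
    L ⨾ (nT ⨾ R) ⨾ L ⨾ L      ≡⟨ cong (λ X → X ⨾ L ⨾ L) (sym (⨾-assoc L nT R)) ⟩
    L ⨾ nT ⨾ R ⨾ L ⨾ L        ⊆⟨ ⨾-monoˡ (⨾-monoˡ (⨾-monoˡ (L⨾∁[L⨾]⊆∁[L⨾] R))) ⟩
    nT ⨾ R ⨾ L ⨾ L            ≡⟨ ⨾-assoc (nT ⨾ R) L L ⟩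
    nT ⨾ R ⨾ (L ⨾ L)          ≡⟨ cong (nT ⨾ R ⨾_) L⨾L≡L ⟩
    nT ⨾ R ⨾ L                ∎
    where nT = ∁ (L ⨾ R)

  sp≢O⇒L≡∁[L⨾R]⨾R⨾L : ∀ R → ¬ sp R ≡ O → L ≡ ∁ (L ⨾ R) ⨾ R ⨾ L
  sp≢O⇒L≡∁[L⨾R]⨾R⨾L R sp≢O = sym (tarski-≡L X≢O (L⨾∁[L⨾R]⨾R⨾L⨾L⊆ R))
    where
    X≢O : ¬ ∁ (L ⨾ R) ⨾ R ⨾ L ≡ O
    X≢O X≡O = sp≢O (Equivalence.from (sp≡O⇔∁[L⨾R]⨾R⨾L≡O R) X≡O)

  L≡⊎≡O⇒⊆ : ∀ {R Y} → (L ≡ Y) ⊎ (R ≡ O) → R ⊆ Y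
  L≡⊎≡O⇒⊆ {R} (inj₁ L≡Y) = subst (R ⊆_) L≡Y ⊆-L
  L≡⊎≡O⇒⊆ {Y = Y} (inj₂ refl) = O-least

  R∩∁[L⨾R]⊆O : ∀ R → R ∩ ∁ (L ⨾ R) ⊆ O
  R∩∁[L⨾R]⊆O R = ⊆-∁-contradiction (⊆-trans x∩y⊆x ⊆-L⨾) x∩y⊆y

  ⊆∁[L⨾R]⨾-drop-I : ∀ {R Y Z} → R ⊆ ∁ (L ⨾ R) ⨾ Y → Y ⊆ I ∪ Z → R ⊆ ∁ (L ⨾ R) ⨾ Z
  ⊆∁[L⨾R]⨾-drop-I {R} {Y} {Z} R⊆nT⨾Y Y⊆I∪Z = ⊆∪⇒⊆ʳ (begin
    R                     ⊆⟨ R⊆nT⨾Y ⟩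
    nT ⨾ Y                ⊆⟨ ⨾-monoʳ Y⊆I∪Z ⟩
    nT ⨾ (I ∪ Z)          ≡⟨ ⨾-distribˡ-∪ nT I Z ⟩
    nT ⨾ I ∪ nT ⨾ Z       ≡⟨ cong (_∪ nT ⨾ Z) (⨾-identityʳ nT) ⟩
    nT ∪ nT ⨾ Z           ∎) (R∩∁[L⨾R]⊆O R)
    where nT = ∁ (L ⨾ R)

  sp≢O⇒⊆∁[L⨾R]⨾⋆ : ∀ {R} → Connected R → ¬ sp R ≡ O → R ⊆ ∁ (L ⨾ R) ⨾ R ⋆
  sp≢O⇒⊆∁[L⨾R]⨾⋆ {R} connected sp≢O = begin
    R                             ⊆⟨ ∩-greatest (subst (R ⊆_) (sym (sp≢O⇒spᵀ⨾L≡L R sp≢O)) ⊆-L) ⊆-refl ⟩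
    sp R ᵀ ⨾ L ∩ R                ⊆⟨ dedekindʳ (sp R ᵀ) L R ⟩
    sp R ᵀ ⨾ (L ∩ (sp R ᵀ) ᵀ ⨾ R) ≡⟨ cong (λ X → sp R ᵀ ⨾ (L ∩ X ⨾ R)) (ᵀ-involutive (sp R)) ⟩
    sp R ᵀ ⨾ (L ∩ sp R ⨾ R)       ⊆⟨ ⨾-mono (spᵀ⊆∁[L⨾R] R) (⊆-trans x∩y⊆y (sp⨾R⊆⋆ connected)) ⟩
    ∁ (L ⨾ R) ⨾ R ⋆               ∎

  ⊆∁[L⨾R]⨾⋆⇒⊆∁[L⨾R]⨾R⨾L : ∀ {R} → R ⊆ ∁ (L ⨾ R) ⨾ R ⋆ → R ⊆ ∁ (L ⨾ R) ⨾ R ⨾ L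
  ⊆∁[L⨾R]⨾⋆⇒⊆∁[L⨾R]⨾R⨾L {R} R⊆nT⨾⋆ = begin
    R                         ⊆⟨ ⊆∁[L⨾R]⨾-drop-I R⊆nT⨾⋆ ⋆⊆I∪⨾⋆ ⟩
    ∁ (L ⨾ R) ⨾ (R ⨾ R ⋆)     ⊆⟨ ⨾-monoʳ (⨾-monoʳ ⊆-L) ⟩
    ∁ (L ⨾ R) ⨾ (R ⨾ L)       ≡⟨ sym (⨾-assoc (∁ (L ⨾ R)) R L) ⟩
    ∁ (L ⨾ R) ⨾ R ⨾ L         ∎

  ⊆∁[L⨾R]⨾⋆⇒⊆ᵀ⋆⨾∁[Rᵀ⨾L] : ∀ {R} → Injective R → R ⊆ ∁ (L ⨾ R) ⨾ R ⋆ → R ⊆ R ᵀ⋆ ⨾ ∁ (R ᵀ ⨾ L)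
  ⊆∁[L⨾R]⨾⋆⇒⊆ᵀ⋆⨾∁[Rᵀ⨾L] {R} injective R⊆nT⨾⋆ = begin
    R                               ⊆⟨ ∩-greatest R⊆nT⨾⋆⨾R ⊆-refl ⟩
    nT ⨾ R ⋆ ⨾ R ∩ R                ⊆⟨ dedekindˡ (nT ⨾ R ⋆) R R ⟩
    (nT ⨾ R ⋆ ∩ R ⨾ R ᵀ) ⨾ R        ⊆⟨ ⨾-monoˡ (∩-mono ⊆-refl injective) ⟩
    (nT ⨾ R ⋆ ∩ I) ⨾ R              ⊆⟨ ⨾-monoˡ (⊆-trans (⊆I⇒⊆ᵀ x∩y⊆y) (ᵀ-mono x∩y⊆x)) ⟩
    (nT ⨾ R ⋆) ᵀ ⨾ R                ≡⟨ cong (_⨾ R) (trans (ᵀ-distrib-⨾ nT (R ⋆)) (cong₂ _⨾_ (ᵀ-⋆ R) (ᵀ-∁[L⨾] R))) ⟩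
    R ᵀ⋆ ⨾ n ⨾ R                    ≡⟨ ⨾-assoc (R ᵀ⋆) n R ⟩
    R ᵀ⋆ ⨾ (n ⨾ R)                  ⊆⟨ ⨾-monoʳ (⊆-trans (⨾-monoʳ ⊆-L) (∁[⨾L]⨾L⊆∁[⨾L] (R ᵀ))) ⟩
    R ᵀ⋆ ⨾ n                        ∎
    where
    nT = ∁ (L ⨾ R)
    n = ∁ (R ᵀ ⨾ L)
    R⊆nT⨾⋆⨾R : R ⊆ nT ⨾ R ⋆ ⨾ R
    R⊆nT⨾⋆⨾R = ⊆-trans (⊆∁[L⨾R]⨾-drop-I R⊆nT⨾⋆ ⋆⊆I∪⋆⨾) (⊆-reflexive (sym (⨾-assoc nT (R ⋆) R)))

  ᵀ⋆⨾∁[⨾L]⊆∁[⨾L] : ∀ R → R ᵀ⋆ ⨾ ∁ (R ⨾ L) ⊆ ∁ (R ⨾ L)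
  ᵀ⋆⨾∁[⨾L]⊆∁[⨾L] R = ⋆-inductˡ (R ᵀ) m m (∪-least ⊆-refl (begin
    R ᵀ ⨾ m     ⊆⟨ schröder R L ⟩
    ∁ L         ≡⟨ sym O≡∁L ⟩
    O           ⊆⟨ O-least ⟩
    m           ∎))
    where m = ∁ (R ⨾ L)

  ⊆ᵀ⋆⨾∁[Rᵀ⨾L]⇒[sp≡O⇒≡O] : ∀ {R} → R ⊆ R ᵀ⋆ ⨾ ∁ (R ᵀ ⨾ L) → sp R ≡ O → R ≡ O
  ⊆ᵀ⋆⨾∁[Rᵀ⨾L]⇒[sp≡O⇒≡O] {R} R⊆ᵀ⋆⨾n sp≡O = ⊆O⇒≡O (⊆-∁-contradiction ⊆-⨾L (begin
    R                         ⊆⟨ R⊆ᵀ⋆⨾n ⟩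
    R ᵀ⋆ ⨾ ∁ (R ᵀ ⨾ L)        ⊆⟨ ⨾-monoʳ n⊆∁[R⨾L] ⟩
    R ᵀ⋆ ⨾ ∁ (R ⨾ L)          ⊆⟨ ᵀ⋆⨾∁[⨾L]⊆∁[⨾L] R ⟩
    ∁ (R ⨾ L)                 ∎))
    where
    n⊆∁[R⨾L] : ∁ (R ᵀ ⨾ L) ⊆ ∁ (R ⨾ L)
    n⊆∁[R⨾L] = ∩⊆O⇒⊆∁ (subst (_⊆ O) (∩-comm (R ⨾ L) (∁ (R ᵀ ⨾ L))) (⊆-reflexive sp≡O))

  BackwardTerminationCriteria : Carrier → Set
  BackwardTerminationCriteria R =
      (BackwardTerminating R ⇔ ((L ≡ ∁ (L ⨾ R) ⨾ R ⨾ L) ⊎ (R ≡ O)))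
    × (BackwardTerminating R ⇔ (R ⊆ ∁ (L ⨾ R) ⨾ R ⨾ L))
    × (BackwardTerminating R ⇔ (R ⊆ ∁ (L ⨾ R) ⨾ R ⋆))
    × (BackwardTerminating R ⇔ (R ⊆ R ᵀ⋆ ⨾ ∁ (R ᵀ ⨾ L)))

  ForwardTerminationCriteria : Carrier → Set
  ForwardTerminationCriteria R =
      (ForwardTerminating R ⇔ ((L ≡ L ⨾ R ⨾ ∁ (R ⨾ L)) ⊎ (R ≡ O)))
    × (ForwardTerminating R ⇔ (R ⊆ L ⨾ R ⨾ ∁ (R ⨾ L)))
    × (ForwardTerminating R ⇔ (R ⊆ R ⋆ ⨾ ∁ (R ⨾ L)))
    × (ForwardTerminating R ⇔ (R ⊆ ∁ (L ⨾ R ᵀ) ⨾ R ᵀ⋆))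

  TerminationCriteria : Carrier → Set
  TerminationCriteria R =
      (Terminating R ⇔ ((L ≡ ∁ (L ⨾ R) ⨾ R ⨾ L ∩ L ⨾ R ⨾ ∁ (R ⨾ L)) ⊎ (R ≡ O)))
    × (Terminating R ⇔ (R ⊆ ∁ (L ⨾ R) ⨾ R ⨾ L ∩ L ⨾ R ⨾ ∁ (R ⨾ L)))
    × (Terminating R ⇔ (R ⊆ ∁ (L ⨾ R) ⨾ R ⋆ ∩ R ⋆ ⨾ ∁ (R ⨾ L)))
    × (Terminating R ⇔ (R ⊆ R ᵀ⋆ ⨾ ∁ (R ᵀ ⨾ L) ∩ ∁ (L ⨾ R ᵀ) ⨾ R ᵀ⋆))

  backwardTerminationCriteria : ExcludedMiddle 0ℓ → ∀ {R} → Injective R → Connected R →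
                                BackwardTerminationCriteria R
  backwardTerminationCriteria em {R} injective connected =
      mk⇔ bt⇒L≡X⊎≡O (⊆X⇒bt ∘ L≡⊎≡O⇒⊆)
    , mk⇔ (L≡⊎≡O⇒⊆ ∘ bt⇒L≡X⊎≡O) ⊆X⇒bt
    , mk⇔ bt⇒⊆nT⨾⋆ (⊆X⇒bt ∘ ⊆∁[L⨾R]⨾⋆⇒⊆∁[L⨾R]⨾R⨾L)
    , mk⇔ (⊆∁[L⨾R]⨾⋆⇒⊆ᵀ⋆⨾∁[Rᵀ⨾L] injective ∘ bt⇒⊆nT⨾⋆)
          (Equivalence.from (¬⊎⇔→ em) ∘ ⊆ᵀ⋆⨾∁[Rᵀ⨾L]⇒[sp≡O⇒≡O])
    where
    X = ∁ (L ⨾ R) ⨾ R ⨾ L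
    bt⇒L≡X⊎≡O : BackwardTerminating R → (L ≡ X) ⊎ (R ≡ O)
    bt⇒L≡X⊎≡O (inj₁ sp≢O) = inj₁ (sp≢O⇒L≡∁[L⨾R]⨾R⨾L R sp≢O)
    bt⇒L≡X⊎≡O (inj₂ R≡O)  = inj₂ R≡O
    ⊆X⇒bt : R ⊆ X → BackwardTerminating R
    ⊆X⇒bt R⊆X = Equivalence.from (¬⊎⇔→ em) λ sp≡O →
      ⊆O⇒≡O (⊆-trans R⊆X (⊆-reflexive (Equivalence.to (sp≡O⇔∁[L⨾R]⨾R⨾L≡O R) sp≡O)))
    bt⇒⊆nT⨾⋆ : BackwardTerminating R → R ⊆ ∁ (L ⨾ R) ⨾ R ⋆
    bt⇒⊆nT⨾⋆ (inj₁ sp≢O) = sp≢O⇒⊆∁[L⨾R]⨾⋆ connected sp≢O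
    bt⇒⊆nT⨾⋆ (inj₂ R≡O)  = L≡⊎≡O⇒⊆ (inj₂ R≡O)

  ᵀ-injective : ∀ {R} → Univalent R → Injective (R ᵀ)
  ᵀ-injective {R} univalent = subst (λ X → R ᵀ ⨾ X ⊆ I) (sym (ᵀ-involutive R)) univalent

  ᵀ-connected : ∀ {R} → Connected R → Connected (R ᵀ)
  ᵀ-connected {R} connected = begin
    R ᵀ ⨾ L ⨾ R ᵀ               ≡⟨ ⨾-assoc (R ᵀ) L (R ᵀ) ⟩
    R ᵀ ⨾ (L ⨾ R ᵀ)             ≡⟨ cong (λ X → R ᵀ ⨾ (X ⨾ R ᵀ)) (sym ᵀ-L) ⟩
    R ᵀ ⨾ (L ᵀ ⨾ R ᵀ)           ≡⟨ cong (R ᵀ ⨾_) (sym (ᵀ-distrib-⨾ R L)) ⟩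
    R ᵀ ⨾ (R ⨾ L) ᵀ             ≡⟨ sym (ᵀ-distrib-⨾ (R ⨾ L) R) ⟩
    (R ⨾ L ⨾ R) ᵀ               ⊆⟨ ᵀ-mono connected ⟩
    (R ⋆ ∪ R ᵀ⋆) ᵀ              ≡⟨ ᵀ-distrib-∪ (R ⋆) (R ᵀ⋆) ⟩
    (R ⋆) ᵀ ∪ (R ᵀ⋆) ᵀ          ≡⟨ cong₂ _∪_ (ᵀ-⋆ R) (ᵀ-⋆ (R ᵀ)) ⟩
    R ᵀ⋆ ∪ (R ᵀ) ᵀ⋆             ∎

  ≡O⇔ᵀ≡O : ∀ {R} → (R ≡ O) ⇔ (R ᵀ ≡ O)
  ≡O⇔ᵀ≡O {R} = mk⇔ (λ R≡O → trans (cong _ᵀ R≡O) ᵀ-O)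
                   (λ Rᵀ≡O → trans (sym (ᵀ-involutive R)) (trans (cong _ᵀ Rᵀ≡O) ᵀ-O))

  forwardTerminating⇔backwardTerminatingᵀ : ∀ R → ForwardTerminating R ⇔ BackwardTerminating (R ᵀ)
  forwardTerminating⇔backwardTerminatingᵀ R =
    subst (λ X → ForwardTerminating R ⇔ ((¬ X ≡ O) ⊎ (R ᵀ ≡ O))) ep≡spᵀ (⇔.refl ⊎-⇔ ≡O⇔ᵀ≡O)
    where
    ep≡spᵀ : ep R ≡ sp (R ᵀ)
    ep≡spᵀ = cong (λ X → R ᵀ ⨾ L ∩ ∁ (X ⨾ L)) (sym (ᵀ-involutive R))

  L≡⇔L≡ᵀ : ∀ {Y Z} → Y ᵀ ≡ Z → (L ≡ Y) ⇔ (L ≡ Z)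
  L≡⇔L≡ᵀ {Y} Yᵀ≡Z = mk⇔
    (λ L≡Y → trans (sym ᵀ-L) (trans (cong _ᵀ L≡Y) Yᵀ≡Z))
    (λ L≡Z → trans (sym ᵀ-L) (trans (cong _ᵀ (trans L≡Z (sym Yᵀ≡Z))) (ᵀ-involutive Y)))

  ⊆⇔ᵀ⊆ : ∀ {R Y Z} → Y ᵀ ≡ Z → (R ⊆ Y) ⇔ (R ᵀ ⊆ Z)
  ⊆⇔ᵀ⊆ {R} Yᵀ≡Z = mk⇔
    (λ R⊆Y → subst (R ᵀ ⊆_) Yᵀ≡Z (ᵀ-mono R⊆Y))
    (λ Rᵀ⊆Z → ᵀ-mono⁻¹ (subst (R ᵀ ⊆_) (sym Yᵀ≡Z) Rᵀ⊆Z))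

  forwardTerminationCriteria : ExcludedMiddle 0ℓ → ∀ {R} → Univalent R → Connected R →
                               ForwardTerminationCriteria R
  forwardTerminationCriteria em {R} univalent connected =
    fromConverse (backwardTerminationCriteria em (ᵀ-injective univalent) (ᵀ-connected connected))
    where
    via : ∀ {P Q} → BackwardTerminating (R ᵀ) ⇔ Q → P ⇔ Q → ForwardTerminating R ⇔ P
    via bt⇔Q P⇔Q = ⇔.trans (forwardTerminating⇔backwardTerminatingᵀ R) (⇔.trans bt⇔Q (⇔.sym P⇔Q))
    e₁ : (L ⨾ R ⨾ ∁ (R ⨾ L)) ᵀ ≡ ∁ (L ⨾ R ᵀ) ⨾ R ᵀ ⨾ L
    e₁ = begin-equality
      (L ⨾ R ⨾ ∁ (R ⨾ L)) ᵀ           ≡⟨ ᵀ-distrib-⨾ (L ⨾ R) (∁ (R ⨾ L)) ⟩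
      (∁ (R ⨾ L)) ᵀ ⨾ (L ⨾ R) ᵀ       ≡⟨ cong₂ _⨾_ (ᵀ-∁[⨾L] R) (ᵀ-distrib-⨾ L R) ⟩
      ∁ (L ⨾ R ᵀ) ⨾ (R ᵀ ⨾ L ᵀ)       ≡⟨ cong (λ X → ∁ (L ⨾ R ᵀ) ⨾ (R ᵀ ⨾ X)) ᵀ-L ⟩
      ∁ (L ⨾ R ᵀ) ⨾ (R ᵀ ⨾ L)         ≡⟨ sym (⨾-assoc (∁ (L ⨾ R ᵀ)) (R ᵀ) L) ⟩
      ∁ (L ⨾ R ᵀ) ⨾ R ᵀ ⨾ L           ∎
    e₃ : (R ⋆ ⨾ ∁ (R ⨾ L)) ᵀ ≡ ∁ (L ⨾ R ᵀ) ⨾ R ᵀ⋆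
    e₃ = trans (ᵀ-distrib-⨾ (R ⋆) (∁ (R ⨾ L))) (cong₂ _⨾_ (ᵀ-∁[⨾L] R) (ᵀ-⋆ R))
    e₄ : (∁ (L ⨾ R ᵀ) ⨾ R ᵀ⋆) ᵀ ≡ (R ᵀ) ᵀ⋆ ⨾ ∁ ((R ᵀ) ᵀ ⨾ L)
    e₄ = trans (ᵀ-distrib-⨾ (∁ (L ⨾ R ᵀ)) (R ᵀ⋆)) (cong₂ _⨾_ (ᵀ-⋆ (R ᵀ)) (ᵀ-∁[L⨾] (R ᵀ)))
    fromConverse : BackwardTerminationCriteria (R ᵀ) → ForwardTerminationCriteria R
    fromConverse (c₁ , c₂ , c₃ , c₄) =
      via c₁ (L≡⇔L≡ᵀ e₁ ⊎-⇔ ≡O⇔ᵀ≡O) , via c₂ (⊆⇔ᵀ⊆ e₁) , via c₃ (⊆⇔ᵀ⊆ e₃) , via c₄ (⊆⇔ᵀ⊆ e₄)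

  ×-⊆⇔⊆∩ : ∀ {R X Y} → (R ⊆ X × R ⊆ Y) ⇔ (R ⊆ X ∩ Y)
  ×-⊆⇔⊆∩ = mk⇔ (λ (R⊆X , R⊆Y) → ∩-greatest R⊆X R⊆Y) (λ R⊆X∩Y → ⊆-trans R⊆X∩Y x∩y⊆x , ⊆-trans R⊆X∩Y x∩y⊆y)

  ×-L≡⇔L≡∩ : ∀ {X Y} → (L ≡ X × L ≡ Y) ⇔ (L ≡ X ∩ Y)
  ×-L≡⇔L≡∩ = mk⇔
    (λ (L≡X , L≡Y) → ⊆-antisym (∩-greatest (⊆-reflexive L≡X) (⊆-reflexive L≡Y)) ⊆-L)
    (λ L≡X∩Y → ⊆-antisym (⊆-trans (⊆-reflexive L≡X∩Y) x∩y⊆x) ⊆-L , ⊆-antisym (⊆-trans (⊆-reflexive L≡X∩Y) x∩y⊆y) ⊆-L)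

  terminationCriteria : ∀ {R} → BackwardTerminationCriteria R → ForwardTerminationCriteria R →
                        TerminationCriteria R
  terminationCriteria (b₁ , b₂ , b₃ , b₄) (f₁ , f₂ , f₃ , f₄) =
      ⇔.trans (b₁ ×-⇔ f₁) (⇔.trans ×-⊎-factor (×-L≡⇔L≡∩ ⊎-⇔ ⇔.refl))
    , ⇔.trans (b₂ ×-⇔ f₂) ×-⊆⇔⊆∩
    , ⇔.trans (b₃ ×-⇔ f₃) ×-⊆⇔⊆∩
    , ⇔.trans (b₄ ×-⇔ f₄) ×-⊆⇔⊆∩

mainTheorem4 : ExcludedMiddle 0ℓ → (A : KleeneRelationAlgebra) →
    let open KleeneRelationAlgebra A in
    (R : Carrier) → IsPath R →
      -- (a)
      ( (BackwardTerminating R ⇔ ((L ≡ ∁ (L ⨾ R) ⨾ R ⨾ L) ⊎ (R ≡ O)))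
      × (BackwardTerminating R ⇔ (R ⊆ ∁ (L ⨾ R) ⨾ R ⨾ L))
      × (BackwardTerminating R ⇔ (R ⊆ ∁ (L ⨾ R) ⨾ R ⋆))
      × (BackwardTerminating R ⇔ (R ⊆ R ᵀ⋆ ⨾ ∁ (R ᵀ ⨾ L))) )
      -- (b)
      × ( (ForwardTerminating R ⇔ ((L ≡ L ⨾ R ⨾ ∁ (R ⨾ L)) ⊎ (R ≡ O)))
      × (ForwardTerminating R ⇔ (R ⊆ L ⨾ R ⨾ ∁ (R ⨾ L)))
      × (ForwardTerminating R ⇔ (R ⊆ R ⋆ ⨾ ∁ (R ⨾ L)))
      × (ForwardTerminating R ⇔ (R ⊆ ∁ (L ⨾ R ᵀ) ⨾ R ᵀ⋆)) )
      -- (c)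
      × ( (Terminating R ⇔ ((L ≡ ∁ (L ⨾ R) ⨾ R ⨾ L ∩ L ⨾ R ⨾ ∁ (R ⨾ L)) ⊎ (R ≡ O)))
      × (Terminating R ⇔ (R ⊆ ∁ (L ⨾ R) ⨾ R ⨾ L ∩ L ⨾ R ⨾ ∁ (R ⨾ L)))
      × (Terminating R ⇔ (R ⊆ ∁ (L ⨾ R) ⨾ R ⋆ ∩ R ⋆ ⨾ ∁ (R ⨾ L)))
      × (Terminating R ⇔ (R ⊆ R ᵀ⋆ ⨾ ∁ (R ᵀ ⨾ L) ∩ ∁ (L ⨾ R ᵀ) ⨾ R ᵀ⋆)) )
mainTheorem4 em A R (injective , univalent , connected) =
  backward , forward , terminationCriteria backward forward
  where
  open KleeneRelationAlgebraProperties A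
  backward : BackwardTerminationCriteria R
  backward = backwardTerminationCriteria em injective connected
  forward : ForwardTerminationCriteria R
  forward = forwardTerminationCriteria em univalent connected
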